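{- For all positive integers $m,n$ and every nonnegative integer $\ell$, \[\mathrm{ex}(m,n,\mathcal{P}_{\le 4}^{\ell+1}) < 4 \ell^{1/4} n^{3/4} m^{1/2} + 10m + 10n.\]
   Context: $\mathrm{ex}(m,n,\mathcal{P}_{\le 4}^{\ell+1})$ denotes the maximum number of edges of a bipartite graph $B$ with bipartition $(U,V)$, $|U|=m$, $|V|=n$, such that between any two vertices of $V$ there are at most $\ell$ distinct paths of length at most 4 in $B$. -}

module Defs where

open import Data.Nat using (ℕ; zero; suc; _+_; _≤_)
open import Data.Bool using (Bool; true; false; _∧_; not; if_then_else_)
open import Data.Fin using (Fin)
open import Data.Fin.Properties using () renaming (_≟_ to _≟F_)
open import Data.List using (List; []; _∷_; [_]; map; concatMap; _++_; allFin)
open import Data.Vec using (Vec; []; _∷_; head; last; toList)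
open import Data.Sum using (_⊎_; inj₁; inj₂)
open import Relation.Nullary.Decidable using (⌊_⌋)
open import Relation.Binary.PropositionalEquality using (_≢_)

-- A bipartite graph B with parts U = Fin m and V = Fin n,
-- given by its (decidable) bi-adjacency relation: B u v = true iff uv is an edge.
BipGraph : ℕ → ℕ → Set
BipGraph m n = Fin m → Fin n → Bool

Vertex : ℕ → ℕ → Set
Vertex m n = Fin m ⊎ Fin n

adj : ∀ {m n} → BipGraph m n → Vertex m n → Vertex m n → Bool
adj B (inj₁ u) (inj₂ v) = B u v
adj B (inj₂ v) (inj₁ u) = B u v
adj B (inj₁ _) (inj₁ _) = false
adj B (inj₂ _) (inj₂ _) = false

eqV : ∀ {m n} → Vertex m n → Vertex m n → Bool
eqV (inj₁ a) (inj₁ b) = ⌊ a ≟F b ⌋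
eqV (inj₂ a) (inj₂ b) = ⌊ a ≟F b ⌋
eqV (inj₁ _) (inj₂ _) = false
eqV (inj₂ _) (inj₁ _) = false

notIn : ∀ {m n} → Vertex m n → List (Vertex m n) → Bool
notIn x [] = true
notIn x (y ∷ ys) = not (eqV x y) ∧ notIn x ys

allDistinct : ∀ {m n} → List (Vertex m n) → Bool
allDistinct [] = true
allDistinct (x ∷ xs) = notIn x xs ∧ allDistinct xs

isWalk : ∀ {m n} {k} → BipGraph m n → Vec (Vertex m n) k → Bool
isWalk B [] = true
isWalk B (x ∷ []) = true
isWalk B (x ∷ y ∷ ys) = adj B x y ∧ isWalk B (y ∷ ys)

isPathFromTo : ∀ {m n} → BipGraph m n → (k : ℕ) → Vertex m n → Vertex m n
             → Vec (Vertex m n) (suc k) → Bool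
isPathFromTo B k x y p =
  eqV (head p) x ∧ eqV (last p) y ∧ isWalk B p ∧ allDistinct (toList p)

allVertices : (m n : ℕ) → List (Vertex m n)
allVertices m n = map inj₁ (allFin m) ++ map inj₂ (allFin n)

allVecs : ∀ {A : Set} → List A → (k : ℕ) → List (Vec A k)
allVecs xs zero = [ [] ]
allVecs xs (suc k) = concatMap (λ x → map (x ∷_) (allVecs xs k)) xs

count : ∀ {A : Set} → (A → Bool) → List A → ℕ
count p [] = 0
count p (x ∷ xs) = if p x then suc (count p xs) else count p xs

numPaths : ∀ {m n} → BipGraph m n → ℕ → Vertex m n → Vertex m n → ℕ
numPaths {m} {n} B k x y =
  count (isPathFromTo B k x y) (allVecs (allVertices m n) (suc k))

numPaths≤4 : ∀ {m n} → BipGraph m n → Vertex m n → Vertex m n → ℕ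
numPaths≤4 B x y =
  numPaths B 1 x y + numPaths B 2 x y + numPaths B 3 x y + numPaths B 4 x y

-- B is P_{≤4}^{ℓ+1}-free: between any two (distinct) vertices of V
-- there are at most ℓ distinct paths of length at most 4.
P≤4Free : ∀ {m n} → ℕ → BipGraph m n → Set
P≤4Free {m} {n} ℓ B =
  (v v' : Fin n) → v ≢ v' → numPaths≤4 B (inj₂ v) (inj₂ v') ≤ ℓ

numEdges : ∀ {m n} → BipGraph m n → ℕ
numEdges {m} {n} B =
  count (λ uv → B (Data.Product.proj₁ uv) (Data.Product.proj₂ uv))
        (Data.List.cartesianProduct (allFin m) (allFin n))
  where import Data.Product

-- Let e be the number of edges, D = ⌊e/m⌋, and give every u ∈ U the weight
-- t(u) = min(d(u) − 2, D).  For w ∈ V put G(w) = Σ_{u ~ w} t(u) and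
-- Q = Σ_w G(w) = Σ_u d(u) t(u).  The off-diagonal part of G(w)² is a weighted
-- count of cherries u – w – u′, and such a cherry extends to at least
-- (d(u) − 1)(d(u′) − 2) ≥ t(u) t(u′) paths v – u – w – u′ – v′.  Since two vertices
-- of V are joined by at most ℓ such paths, Σ_w G(w)² ≤ n²ℓ + DQ, and Cauchy–Schwarz
-- gives Q² ≤ n (n²ℓ + DQ).  On the other hand 4Dd ≤ 4d·min(d − 2, D) + 8d + D²
-- summed over U gives 4De ≤ 4Q + 8e + mD², so Q ≥ De/2 once e ≥ 10(m + n).
-- Together these force e⁴ ≤ 20 m² n³ ℓ.
module Submission where

open import Defs
open import Data.Nat using (ℕ; _+_; _*_; _∸_; _^_; _≤_; _<_)
open import Data.Sum using (_⊎_)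

open import Data.Bool using (Bool; true; false; not; _∧_; T; if_then_else_)
open import Data.Bool.Properties using (T-∧; T-≡)
open import Data.Empty using (⊥-elim)
open import Data.Fin using (Fin; zero; suc)
open import Data.Fin.Properties using (_≟_)
open import Data.List using (List; []; _∷_; _++_; map; concatMap; tabulate; allFin; cartesianProduct)
open import Data.List.Properties using (map-tabulate; concatMap-++)
open import Data.Nat using (zero; suc; z≤n; s≤s; s≤s⁻¹; _⊓_; _<?_; NonZero; >-nonZero)
open import Data.Nat.DivMod using (_/_; m/n*n≤m; m≡m%n+[m/n]*n; m%n<n)
open import Data.Nat.Properties hiding (_≟_)
open import Data.Nat.Tactic.RingSolver using (solve; solve-∀)
open import Data.Product using (_×_; _,_; proj₁; proj₂)
open import Data.Sum using (inj₁; inj₂)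
open import Data.Unit using (tt)
open import Function using (_∘_; id)
open import Function.Bundles using (module Equivalence)
open import Relation.Nullary using (¬_; Dec; yes; no; does)
open import Relation.Binary.PropositionalEquality
  using (_≡_; _≢_; refl; sym; trans; cong; cong₂; subst; ≢-sym; ≡-≟-identity; ≢-≟-identity; module ≡-Reasoning)
open import Algebra.Properties.Semiring.Sum +-*-semiring
  using (sum; sum-syntax; sum-cong-≗; sum-replicate-zero; ∑-comm; ∑-distrib-+; *-distribˡ-sum; *-distribʳ-sum)

open Equivalence using (to; from)

-- Finite sums

∑-mono-≤ : ∀ {n} {f g : Fin n → ℕ} → (∀ i → f i ≤ g i) → sum f ≤ sum g
∑-mono-≤ {zero}  _   = z≤n
∑-mono-≤ {suc n} f≤g = +-mono-≤ (f≤g zero) (∑-mono-≤ (f≤g ∘ suc))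

f≤∑f : ∀ {n} (f : Fin n → ℕ) i → f i ≤ sum f
f≤∑f f zero    = m≤m+n _ _
f≤∑f f (suc i) = ≤-trans (f≤∑f (f ∘ suc) i) (m≤n+m _ _)

∑-const : ∀ n c → ∑[ i < n ] c ≡ n * c
∑-const zero    c = refl
∑-const (suc n) c = cong (c +_) (∑-const n c)

∑-zero : ∀ {n} {f : Fin n → ℕ} → (∀ i → f i ≡ 0) → sum f ≡ 0
∑-zero {n} f≗0 = trans (sum-cong-≗ f≗0) (sum-replicate-zero n)

∑-comm² : ∀ {k m n} (F : Fin k → Fin m → Fin n → ℕ) →
  ∑[ i < k ] ∑[ j < m ] ∑[ l < n ] F i j l ≡ ∑[ j < m ] ∑[ l < n ] ∑[ i < k ] F i j l
∑-comm² F = trans (∑-comm (λ i j → ∑[ l < _ ] F i j l)) (sum-cong-≗ λ j → ∑-comm (λ i → F i j))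

∑∑-products : ∀ {m n} (f : Fin m → ℕ) (g : Fin n → ℕ) →
  sum f * sum g ≡ ∑[ i < m ] ∑[ j < n ] (f i * g j)
∑∑-products f g = trans (*-distribʳ-sum (sum g) f) (sum-cong-≗ λ i → *-distribˡ-sum (f i) g)

2mn≤m²+n² : ∀ m n → 2 * (m * n) ≤ m * m + n * n
2mn≤m²+n² zero    n       = z≤n
2mn≤m²+n² (suc m) zero    rewrite *-zeroʳ m = z≤n
2mn≤m²+n² (suc m) (suc n) = begin
  2 * (suc m * suc n)                  ≡⟨ solve (m ∷ n ∷ []) ⟩
  2 + 2 * m + 2 * n + 2 * (m * n)      ≤⟨ +-monoʳ-≤ (2 + 2 * m + 2 * n) (2mn≤m²+n² m n) ⟩
  2 + 2 * m + 2 * n + (m * m + n * n)  ≡⟨ solve (m ∷ n ∷ []) ⟩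
  suc m * suc m + suc n * suc n        ∎
  where open ≤-Reasoning

cauchy-schwarz : ∀ {n} (f : Fin n → ℕ) → sum f * sum f ≤ n * ∑[ i < n ] (f i * f i)
cauchy-schwarz {n} f = *-cancelˡ-≤ 2 (begin
  2 * (sum f * sum f)                             ≡⟨ cong (2 *_) (∑∑-products f f) ⟩
  2 * ∑[ i < n ] ∑[ j < n ] (f i * f j)            ≡⟨ *-distribˡ-sum 2 (λ i → ∑[ j < n ] (f i * f j)) ⟩
  ∑[ i < n ] (2 * ∑[ j < n ] (f i * f j))          ≡⟨ sum-cong-≗ (λ i → *-distribˡ-sum 2 (λ j → f i * f j)) ⟩
  ∑[ i < n ] ∑[ j < n ] (2 * (f i * f j))          ≤⟨ ∑-mono-≤ (λ i → ∑-mono-≤ λ j → 2mn≤m²+n² (f i) (f j)) ⟩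
  ∑[ i < n ] ∑[ j < n ] (f i * f i + f j * f j)    ≡⟨ sum-cong-≗ (λ i → ∑-distrib-+ (λ _ → f i * f i) (λ j → f j * f j)) ⟩
  ∑[ i < n ] (∑[ j < n ] (f i * f i) + ∑f²)        ≡⟨ sum-cong-≗ (λ i → cong (_+ ∑f²) (∑-const n (f i * f i))) ⟩
  ∑[ i < n ] (n * (f i * f i) + ∑f²)               ≡⟨ ∑-distrib-+ (λ i → n * (f i * f i)) (λ _ → ∑f²) ⟩
  ∑[ i < n ] (n * (f i * f i)) + ∑[ i < n ] ∑f²    ≡⟨ cong₂ _+_ (sym (*-distribˡ-sum n (λ i → f i * f i))) (∑-const n ∑f²) ⟩
  n * ∑f² + n * ∑f²                                ≡⟨ cong (n * ∑f² +_) (+-identityʳ _) ⟨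
  2 * (n * ∑f²)                                    ∎)
  where
  open ≤-Reasoning
  ∑f² = ∑[ i < n ] (f i * f i)

-- Indicators and counting

χ : Bool → ℕ
χ b = if b then 1 else 0

χ≤1 : ∀ b → χ b ≤ 1
χ≤1 true  = ≤-refl
χ≤1 false = z≤n

χ-∧ : ∀ a b → χ (a ∧ b) ≡ χ a * χ b
χ-∧ true  b = sym (*-identityˡ (χ b))
χ-∧ false b = refl

χ-mono : ∀ {a b} → (T a → T b) → χ a ≤ χ b
χ-mono {false}        _   = z≤n
χ-mono {true} {true}  _   = ≤-refl
χ-mono {true} {false} a⇒b = ⊥-elim (a⇒b _)

χ≡0 : ∀ {b} → ¬ T b → χ b ≡ 0
χ≡0 {false} _  = refl
χ≡0 {true}  ¬b = ⊥-elim (¬b _)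

χ*-≤ : ∀ {b x y} → (T b → x ≤ y) → χ b * x ≤ y
χ*-≤ {false}     _   = z≤n
χ*-≤ {true}  {x} b⇒≤ = ≤-trans (≤-reflexive (*-identityˡ x)) (b⇒≤ _)

T-∧³ : ∀ {a b c} → T (a ∧ b ∧ c) → T a × T b × T c
T-∧³ {a} {b} {c} h = let ta , tbc = to (T-∧ {a} {b ∧ c}) h in ta , to (T-∧ {b} {c}) tbc

_≢ᵇ_ : ∀ {n} → Fin n → Fin n → Bool
i ≢ᵇ j = not (does (i ≟ j))

T-≢ᵇ : ∀ {n} {i j : Fin n} → T (i ≢ᵇ j) → i ≢ j
T-≢ᵇ {i = i} {j} i≢ᵇj with i ≟ j
... | yes _  = ⊥-elim i≢ᵇj
... | no i≢j = i≢j

∑-split : ∀ {n} (f : Fin n → ℕ) i → sum f ≡ ∑[ j < n ] (χ (i ≢ᵇ j) * f j) + f i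
∑-split {suc n} f zero = begin
  f zero + sum (f ∘ suc)               ≡⟨ +-comm (f zero) _ ⟩
  sum (f ∘ suc) + f zero               ≡⟨ cong (_+ f zero) (sum-cong-≗ λ j → *-identityˡ (f (suc j))) ⟨
  ∑[ j < n ] (1 * f (suc j)) + f zero  ∎
  where open ≡-Reasoning
∑-split {suc n} f (suc i) = begin
  f zero + sum (f ∘ suc)               ≡⟨ cong (f zero +_) (∑-split (f ∘ suc) i) ⟩
  f zero + (rest + f (suc i))          ≡⟨ +-assoc (f zero) rest (f (suc i)) ⟨
  f zero + rest + f (suc i)            ≡⟨ cong (λ x → x + rest + f (suc i)) (*-identityˡ (f zero)) ⟨
  1 * f zero + rest + f (suc i)        ∎
  where
  open ≡-Reasoning
  rest = ∑[ j < n ] (χ (i ≢ᵇ j) * f (suc j))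

∑χ∸1≤∑χ≢ : ∀ {n} (P : Fin n → Bool) i → ∑[ j < n ] χ (P j) ∸ 1 ≤ ∑[ j < n ] χ (i ≢ᵇ j ∧ P j)
∑χ∸1≤∑χ≢ {n} P i = m≤n+o⇒m∸n≤o _ 1 (begin
  ∑[ j < n ] χ (P j)                               ≡⟨ ∑-split (χ ∘ P) i ⟩
  ∑[ j < n ] (χ (i ≢ᵇ j) * χ (P j)) + χ (P i)      ≤⟨ +-mono-≤ (≤-reflexive (sum-cong-≗ λ j → sym (χ-∧ (i ≢ᵇ j) (P j)))) (χ≤1 (P i)) ⟩
  ∑[ j < n ] χ (i ≢ᵇ j ∧ P j) + 1                  ≡⟨ +-comm _ 1 ⟩
  1 + ∑[ j < n ] χ (i ≢ᵇ j ∧ P j)                  ∎)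
  where open ≤-Reasoning

∑χ∸2≤∑χ≢≢ : ∀ {n} (P : Fin n → Bool) i k →
  ∑[ j < n ] χ (P j) ∸ 2 ≤ ∑[ j < n ] χ (i ≢ᵇ j ∧ k ≢ᵇ j ∧ P j)
∑χ∸2≤∑χ≢≢ {n} P i k = begin
  ∑[ j < n ] χ (P j) ∸ 2               ≡⟨ ∸-+-assoc (∑[ j < n ] χ (P j)) 1 1 ⟨
  ∑[ j < n ] χ (P j) ∸ 1 ∸ 1           ≤⟨ ∸-monoˡ-≤ 1 (∑χ∸1≤∑χ≢ P k) ⟩
  ∑[ j < n ] χ (k ≢ᵇ j ∧ P j) ∸ 1      ≤⟨ ∑χ∸1≤∑χ≢ (λ j → k ≢ᵇ j ∧ P j) i ⟩
  ∑[ j < n ] χ (i ≢ᵇ j ∧ k ≢ᵇ j ∧ P j) ∎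
  where open ≤-Reasoning

count-∷ : ∀ {A : Set} (p : A → Bool) x xs → count p (x ∷ xs) ≡ χ (p x) + count p xs
count-∷ p x xs with p x
... | true  = refl
... | false = refl

count-++ : ∀ {A : Set} (p : A → Bool) xs ys → count p (xs ++ ys) ≡ count p xs + count p ys
count-++ p []       ys = refl
count-++ p (x ∷ xs) ys with p x
... | true  = cong suc (count-++ p xs ys)
... | false = count-++ p xs ys

count-map : ∀ {A B : Set} (p : B → Bool) (f : A → B) xs → count p (map f xs) ≡ count (p ∘ f) xs
count-map p f []       = refl
count-map p f (x ∷ xs) with p (f x)
... | true  = cong suc (count-map p f xs)
... | false = count-map p f xs

count-tabulate : ∀ {A : Set} {k} (p : A → Bool) (f : Fin k → A) →
  count p (tabulate f) ≡ ∑[ i < k ] χ (p (f i))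
count-tabulate {k = zero}  p f = refl
count-tabulate {k = suc k} p f =
  trans (count-∷ p (f zero) (tabulate (f ∘ suc))) (cong (χ (p (f zero)) +_) (count-tabulate p (f ∘ suc)))

count-concatMap-tabulate : ∀ {A B : Set} {k} (p : B → Bool) (g : A → List B) (f : Fin k → A) →
  count p (concatMap g (tabulate f)) ≡ ∑[ i < k ] count p (g (f i))
count-concatMap-tabulate {k = zero}  p g f = refl
count-concatMap-tabulate {k = suc k} p g f =
  trans (count-++ p (g (f zero)) _) (cong (count p (g (f zero)) +_) (count-concatMap-tabulate p g (f ∘ suc)))

cartesianProduct≡concatMap : ∀ {A B : Set} (xs : List A) (ys : List B) →
  cartesianProduct xs ys ≡ concatMap (λ x → map (x ,_) ys) xs
cartesianProduct≡concatMap []       ys = refl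
cartesianProduct≡concatMap (x ∷ xs) ys = cong (map (x ,_) ys ++_) (cartesianProduct≡concatMap xs ys)

d⊓D≤2+[d∸2]⊓D : ∀ d D → d ⊓ D ≤ 2 + (d ∸ 2) ⊓ D
d⊓D≤2+[d∸2]⊓D d D = begin
  d ⊓ D                    ≤⟨ ⊓-mono-≤ (m≤n+m∸n d 2) (m≤n+m D 2) ⟩
  (2 + (d ∸ 2)) ⊓ (2 + D)  ≡⟨ +-distribˡ-⊓ 2 (d ∸ 2) D ⟨
  2 + (d ∸ 2) ⊓ D          ∎
  where open ≤-Reasoning

4Dd≤4d[d⊓D]+D² : ∀ d D → 4 * (D * d) ≤ 4 * (d * (d ⊓ D)) + D * D
4Dd≤4d[d⊓D]+D² d D with ≤-total d D
... | inj₁ d≤D rewrite m≤n⇒m⊓n≡m d≤D = begin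
  4 * (D * d)                ≡⟨ solve (d ∷ D ∷ []) ⟩
  2 * ((2 * d) * D)          ≤⟨ 2mn≤m²+n² (2 * d) D ⟩
  (2 * d) * (2 * d) + D * D  ≡⟨ solve (d ∷ D ∷ []) ⟩
  4 * (d * d) + D * D        ∎
  where open ≤-Reasoning
... | inj₂ D≤d rewrite m≥n⇒m⊓n≡n D≤d = ≤-trans (≤-reflexive (cong (4 *_) (*-comm D d))) (m≤m+n _ _)

4Dd≤4dt+8d+D² : ∀ d D t → d ⊓ D ≤ 2 + t → 4 * (D * d) ≤ 4 * (d * t) + 8 * d + D * D
4Dd≤4dt+8d+D² d D t d⊓D≤2+t = begin
  4 * (D * d)                  ≤⟨ 4Dd≤4d[d⊓D]+D² d D ⟩
  4 * (d * (d ⊓ D)) + D * D    ≤⟨ +-monoˡ-≤ (D * D) (*-monoʳ-≤ 4 (*-monoʳ-≤ d d⊓D≤2+t)) ⟩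
  4 * (d * (2 + t)) + D * D    ≡⟨ solve (d ∷ t ∷ D ∷ []) ⟩
  4 * (d * t) + 8 * d + D * D  ∎
  where open ≤-Reasoning

10≤D : ∀ {m e D} → 10 * m ≤ e → e < m + D * m → 10 ≤ D
10≤D {m} {e} {D} 10m≤e e<m+Dm = s≤s⁻¹ (*-cancelʳ-< m 10 (suc D) (≤-<-trans 10m≤e e<m+Dm))

De≤2Q : ∀ {m e D Q} → 8 ≤ D → D * m ≤ e →
  4 * (D * e) ≤ 4 * Q + 8 * e + m * (D * D) → D * e ≤ 2 * Q
De≤2Q {m} {e} {D} {Q} 8≤D Dm≤e hQ = *-cancelˡ-≤ 2 (+-cancelʳ-≤ (2 * (D * e)) _ _ (begin
  2 * (D * e) + 2 * (D * e)     ≡⟨ solve (D ∷ e ∷ []) ⟩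
  4 * (D * e)                   ≤⟨ hQ ⟩
  4 * Q + 8 * e + m * (D * D)   ≤⟨ +-mono-≤ (+-monoʳ-≤ (4 * Q) (*-monoˡ-≤ e 8≤D)) mD²≤De ⟩
  4 * Q + D * e + D * e         ≡⟨ solve (Q ∷ D ∷ e ∷ []) ⟩
  2 * (2 * Q) + 2 * (D * e)     ∎))
  where
  open ≤-Reasoning
  mD²≤De : m * (D * D) ≤ D * e
  mD²≤De = begin
    m * (D * D)  ≡⟨ solve (m ∷ D ∷ []) ⟩
    D * (D * m)  ≤⟨ *-monoʳ-≤ D Dm≤e ⟩
    D * e        ∎

4Q²≤5n³ℓ : ∀ {n ℓ e D Q} → 10 * n ≤ e → D * e ≤ 2 * Q →
  Q * Q ≤ n * (n * (n * ℓ) + D * Q) → 4 * (Q * Q) ≤ 5 * (n * (n * (n * ℓ)))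
4Q²≤5n³ℓ {n} {ℓ} {e} {D} {Q} 10n≤e De≤2Q hCS = +-cancelʳ-≤ (Q * Q) _ _ (begin
  4 * (Q * Q) + Q * Q                          ≡⟨ solve (Q ∷ []) ⟩
  5 * (Q * Q)                                  ≤⟨ *-monoʳ-≤ 5 hCS ⟩
  5 * (n * (n * (n * ℓ) + D * Q))              ≡⟨ solve (n ∷ ℓ ∷ D ∷ Q ∷ []) ⟩
  5 * (n * (n * (n * ℓ))) + 5 * (n * D) * Q    ≤⟨ +-monoʳ-≤ (5 * (n * (n * (n * ℓ)))) (*-monoˡ-≤ Q 5nD≤Q) ⟩
  5 * (n * (n * (n * ℓ))) + Q * Q              ∎)
  where
  open ≤-Reasoning
  5nD≤Q : 5 * (n * D) ≤ Q
  5nD≤Q = *-cancelˡ-≤ 2 (begin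
    2 * (5 * (n * D))  ≡⟨ solve (n ∷ D ∷ []) ⟩
    D * (10 * n)       ≤⟨ *-monoʳ-≤ D 10n≤e ⟩
    D * e              ≤⟨ De≤2Q ⟩
    2 * Q              ∎)

e²≤4mQ : ∀ {m e D Q} → 1 ≤ D → e < m + D * m → D * e ≤ 2 * Q → e * e ≤ 4 * (m * Q)
e²≤4mQ {m} {e} {D} {Q} 1≤D e<m+Dm De≤2Q = begin
  e * e                ≤⟨ *-monoˡ-≤ e e≤2Dm ⟩
  (D * m + D * m) * e  ≡⟨ solve (D ∷ m ∷ e ∷ []) ⟩
  2 * m * (D * e)      ≤⟨ *-monoʳ-≤ (2 * m) De≤2Q ⟩
  2 * m * (2 * Q)      ≡⟨ solve (m ∷ Q ∷ []) ⟩
  4 * (m * Q)          ∎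
  where
  open ≤-Reasoning
  e≤2Dm : e ≤ D * m + D * m
  e≤2Dm = ≤-trans (<⇒≤ e<m+Dm) (+-monoˡ-≤ (D * m) (≤-trans (≤-reflexive (sym (*-identityˡ m))) (*-monoˡ-≤ m 1≤D)))

edge-arithmetic : ∀ {m n ℓ e D Q} → 1 ≤ m → 10 * m + 10 * n ≤ e → D * m ≤ e → e < m + D * m →
  4 * (D * e) ≤ 4 * Q + 8 * e + m * (D * D) → Q * Q ≤ n * (n * (n * ℓ) + D * Q) →
  (e ∸ (10 * m + 10 * n)) ^ 4 < 256 * ℓ * n ^ 3 * m ^ 2
edge-arithmetic {m} {n} {ℓ} {e} {D} {Q} 1≤m c≤e Dm≤e e<m+Dm hQ hCS = begin-strict
  (e ∸ c) ^ 4                                     <⟨ ^-monoˡ-< 4 (∸-monoʳ-< 0<c c≤e) ⟩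
  e * (e * (e * (e * 1)))                         ≡⟨ solve (e ∷ []) ⟩
  (e * e) * (e * e)                               ≤⟨ *-mono-≤ 4mQ≥e² 4mQ≥e² ⟩
  (4 * (m * Q)) * (4 * (m * Q))                   ≡⟨ solve (m ∷ Q ∷ []) ⟩
  4 * (m * m) * (4 * (Q * Q))                     ≤⟨ *-monoʳ-≤ (4 * (m * m)) (4Q²≤5n³ℓ {n} {ℓ} {e} {D} {Q} 10n≤e 2Q≥De hCS) ⟩
  4 * (m * m) * (5 * (n * (n * (n * ℓ))))         ≡⟨ solve (m ∷ n ∷ ℓ ∷ []) ⟩
  20 * (ℓ * (n * (n * (n * 1))) * (m * (m * 1)))  ≤⟨ *-monoˡ-≤ (ℓ * (n * (n * (n * 1))) * (m * (m * 1))) (m≤m+n 20 236) ⟩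
  256 * (ℓ * (n * (n * (n * 1))) * (m * (m * 1))) ≡⟨ solve (m ∷ n ∷ ℓ ∷ []) ⟩
  256 * ℓ * (n * (n * (n * 1))) * (m * (m * 1))   ≡⟨⟩
  256 * ℓ * n ^ 3 * m ^ 2                         ∎
  where
  open ≤-Reasoning
  c = 10 * m + 10 * n
  0<c : 0 < c
  0<c = ≤-trans (s≤s z≤n) (≤-trans (*-monoʳ-≤ 10 1≤m) (m≤m+n (10 * m) (10 * n)))
  10n≤e : 10 * n ≤ e
  10n≤e = ≤-trans (m≤n+m (10 * n) (10 * m)) c≤e
  D≥10 : 10 ≤ D
  D≥10 = 10≤D {m} {e} {D} (≤-trans (m≤m+n (10 * m) (10 * n)) c≤e) e<m+Dm
  2Q≥De : D * e ≤ 2 * Q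
  2Q≥De = De≤2Q {m} {e} {D} {Q} (≤-trans (m≤m+n 8 2) D≥10) Dm≤e hQ
  4mQ≥e² : e * e ≤ 4 * (m * Q)
  4mQ≥e² = e²≤4mQ {m} {e} {D} {Q} (≤-trans (s≤s z≤n) D≥10) e<m+Dm 2Q≥De

-- Degrees and weights


deg : ∀ {m n} → BipGraph m n → Fin m → ℕ
deg {n = n} B u = ∑[ w < n ] χ (B u w)

numEdges≡∑deg : ∀ {m n} (B : BipGraph m n) → numEdges B ≡ ∑[ u < m ] deg B u
numEdges≡∑deg {m} {n} B = begin
  count edge (cartesianProduct (allFin m) (allFin n))
    ≡⟨ cong (count edge) (cartesianProduct≡concatMap (allFin m) (allFin n)) ⟩
  count edge (concatMap row (allFin m))
    ≡⟨ count-concatMap-tabulate edge row id ⟩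
  ∑[ u < m ] count edge (row u)
    ≡⟨ sum-cong-≗ (λ u → trans (count-map edge (u ,_) (allFin n)) (count-tabulate (B u) id)) ⟩
  ∑[ u < m ] deg B u
    ∎
  where
  open ≡-Reasoning
  edge : Fin m × Fin n → Bool
  edge uw = B (proj₁ uw) (proj₂ uw)
  row : Fin m → List (Fin m × Fin n)
  row u = map (u ,_) (allFin n)

cherry : ∀ {m n} → BipGraph m n → Fin m → Fin n → Fin m → Bool
cherry B u w u′ = B u w ∧ B u′ w ∧ u ≢ᵇ u′

module Weights {m n} (B : BipGraph m n) (D : ℕ) where

  weight : Fin m → ℕ
  weight u = (deg B u ∸ 2) ⊓ D

  weightAt : Fin n → ℕ
  weightAt w = ∑[ u < m ] (χ (B u w) * weight u)

  cherryWeightAt : Fin n → ℕ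
  cherryWeightAt w = ∑[ u < m ] ∑[ u′ < m ] (χ (cherry B u w u′) * (weight u * weight u′))

  totalWeight : ℕ
  totalWeight = ∑[ w < n ] weightAt w

  weightAt² : ∀ w → weightAt w * weightAt w ≤ cherryWeightAt w + D * weightAt w
  weightAt² w = begin
    weightAt w * weightAt w
      ≡⟨ ∑∑-products a a ⟩
    ∑[ u < m ] ∑[ u′ < m ] (a u * a u′)
      ≡⟨ sum-cong-≗ (λ u → ∑-split (λ u′ → a u * a u′) u) ⟩
    ∑[ u < m ] (∑[ u′ < m ] (χ (u ≢ᵇ u′) * (a u * a u′)) + a u * a u)
      ≡⟨ ∑-distrib-+ (λ u → ∑[ u′ < m ] (χ (u ≢ᵇ u′) * (a u * a u′))) (λ u → a u * a u) ⟩
    ∑[ u < m ] ∑[ u′ < m ] (χ (u ≢ᵇ u′) * (a u * a u′)) + ∑[ u < m ] (a u * a u)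
      ≤⟨ +-mono-≤ (≤-reflexive (sum-cong-≗ λ u → sum-cong-≗ (off-diagonal u)))
                  (∑-mono-≤ λ u → *-monoˡ-≤ (a u) (a≤D u)) ⟩
    cherryWeightAt w + ∑[ u < m ] (D * a u)
      ≡⟨ cong (cherryWeightAt w +_) (*-distribˡ-sum D a) ⟨
    cherryWeightAt w + D * weightAt w
      ∎
    where
    open ≤-Reasoning
    a : Fin m → ℕ
    a u = χ (B u w) * weight u
    a≤D : ∀ u → a u ≤ D
    a≤D u = χ*-≤ {B u w} (λ _ → m⊓n≤n (deg B u ∸ 2) D)
    rearrange : ∀ c x y s t → c * ((x * s) * (y * t)) ≡ (x * (y * c)) * (s * t)
    rearrange = solve-∀
    off-diagonal : ∀ u u′ → χ (u ≢ᵇ u′) * (a u * a u′) ≡ χ (cherry B u w u′) * (weight u * weight u′)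
    off-diagonal u u′ = begin-equality
      χ (u ≢ᵇ u′) * (a u * a u′)
        ≡⟨ rearrange (χ (u ≢ᵇ u′)) (χ (B u w)) (χ (B u′ w)) (weight u) (weight u′) ⟩
      χ (B u w) * (χ (B u′ w) * χ (u ≢ᵇ u′)) * (weight u * weight u′)
        ≡⟨ cong (_* (weight u * weight u′)) (trans (χ-∧ (B u w) _) (cong (χ (B u w) *_) (χ-∧ (B u′ w) (u ≢ᵇ u′)))) ⟨
      χ (cherry B u w u′) * (weight u * weight u′)
        ∎

  totalWeight≡∑deg*weight : totalWeight ≡ ∑[ u < m ] (deg B u * weight u)
  totalWeight≡∑deg*weight =
    trans (∑-comm (λ w u → χ (B u w) * weight u))
          (sum-cong-≗ λ u → sym (*-distribʳ-sum (weight u) (λ w → χ (B u w))))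

  totalWeight-lower : 4 * (D * numEdges B) ≤ 4 * totalWeight + 8 * numEdges B + m * (D * D)
  totalWeight-lower = begin
    4 * (D * numEdges B)
      ≡⟨ cong (λ e → 4 * (D * e)) (numEdges≡∑deg B) ⟩
    4 * (D * ∑[ u < m ] deg B u)
      ≡⟨ trans (cong (4 *_) (*-distribˡ-sum D (deg B))) (*-distribˡ-sum 4 (λ u → D * deg B u)) ⟩
    ∑[ u < m ] (4 * (D * deg B u))
      ≤⟨ ∑-mono-≤ (λ u → 4Dd≤4dt+8d+D² (deg B u) D (weight u) (d⊓D≤2+[d∸2]⊓D (deg B u) D)) ⟩
    ∑[ u < m ] (4 * (deg B u * weight u) + 8 * deg B u + D * D)
      ≡⟨ ∑-distrib-+ (λ u → 4 * (deg B u * weight u) + 8 * deg B u) (λ _ → D * D) ⟩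
    ∑[ u < m ] (4 * (deg B u * weight u) + 8 * deg B u) + ∑[ u < m ] (D * D)
      ≡⟨ cong₂ _+_ (∑-distrib-+ (λ u → 4 * (deg B u * weight u)) (λ u → 8 * deg B u)) (∑-const m (D * D)) ⟩
    ∑[ u < m ] (4 * (deg B u * weight u)) + ∑[ u < m ] (8 * deg B u) + m * (D * D)
      ≡⟨ cong₂ (λ s t → s + t + m * (D * D)) (*-distribˡ-sum 4 (λ u → deg B u * weight u)) (*-distribˡ-sum 8 (deg B)) ⟨
    4 * ∑[ u < m ] (deg B u * weight u) + 8 * ∑[ u < m ] deg B u + m * (D * D)
      ≡⟨ cong₂ (λ q e → 4 * q + 8 * e + m * (D * D)) totalWeight≡∑deg*weight (numEdges≡∑deg B) ⟨
    4 * totalWeight + 8 * numEdges B + m * (D * D)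
      ∎
    where open ≤-Reasoning

-- Paths of length four

-- Brought into scope only here: once the vector constructors overload [] and _∷_,
-- the ring solver's macro becomes unusably slow on its list-literal arguments.
open import Data.Vec using (Vec; []; _∷_)

count-allVecs-suc : ∀ {m n k} (p : Vec (Vertex m n) (suc k) → Bool) →
  count p (allVecs (allVertices m n) (suc k))
  ≡ ∑[ u < m ] count (p ∘ (inj₁ u ∷_)) (allVecs (allVertices m n) k)
  + ∑[ w < n ] count (p ∘ (inj₂ w ∷_)) (allVecs (allVertices m n) k)
count-allVecs-suc {m} {n} {k} p = begin
  count p (concatMap extend (map inj₁ (allFin m) ++ map inj₂ (allFin n)))
    ≡⟨ cong (count p) (concatMap-++ extend (map inj₁ (allFin m)) (map inj₂ (allFin n))) ⟩
  count p (concatMap extend (map inj₁ (allFin m)) ++ concatMap extend (map inj₂ (allFin n)))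
    ≡⟨ count-++ p (concatMap extend (map inj₁ (allFin m))) (concatMap extend (map inj₂ (allFin n))) ⟩
  count p (concatMap extend (map inj₁ (allFin m))) + count p (concatMap extend (map inj₂ (allFin n)))
    ≡⟨ cong₂ _+_ (count-extend inj₁) (count-extend inj₂) ⟩
  ∑[ u < m ] count (p ∘ (inj₁ u ∷_)) (allVecs (allVertices m n) k)
  + ∑[ w < n ] count (p ∘ (inj₂ w ∷_)) (allVecs (allVertices m n) k)
    ∎
  where
  open ≡-Reasoning
  extend : Vertex m n → List (Vec (Vertex m n) (suc k))
  extend x = map (x ∷_) (allVecs (allVertices m n) k)
  count-extend : ∀ {j} (f : Fin j → Vertex m n) →
    count p (concatMap extend (map f (allFin j))) ≡ ∑[ i < j ] count (p ∘ (f i ∷_)) (allVecs (allVertices m n) k)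
  count-extend f = trans (cong (count p ∘ concatMap extend) (map-tabulate id f))
    (trans (count-concatMap-tabulate p extend f)
           (sum-cong-≗ λ i → count-map p (f i ∷_) (allVecs (allVertices m n) k)))

module _ {m n k} (p : Vec (Vertex m n) (suc k) → Bool) where

  ∑-count-inj₁∷≤ : ∑[ u < m ] count (p ∘ (inj₁ u ∷_)) (allVecs (allVertices m n) k)
                   ≤ count p (allVecs (allVertices m n) (suc k))
  ∑-count-inj₁∷≤ = ≤-trans (m≤m+n _ _) (≤-reflexive (sym (count-allVecs-suc p)))

  ∑-count-inj₂∷≤ : ∑[ w < n ] count (p ∘ (inj₂ w ∷_)) (allVecs (allVertices m n) k)
                   ≤ count p (allVecs (allVertices m n) (suc k))
  ∑-count-inj₂∷≤ = ≤-trans (m≤n+m _ _) (≤-reflexive (sym (count-allVecs-suc p)))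

  count-inj₂∷≤ : ∀ w → count (p ∘ (inj₂ w ∷_)) (allVecs (allVertices m n) k)
                       ≤ count p (allVecs (allVertices m n) (suc k))
  count-inj₂∷≤ w = ≤-trans (f≤∑f (λ w → count (p ∘ (inj₂ w ∷_)) (allVecs (allVertices m n) k)) w) ∑-count-inj₂∷≤

fourPath : ∀ {m n} → Fin n → Fin m → Fin n → Fin m → Fin n → Vec (Vertex m n) 5
fourPath v u w u′ v′ = inj₂ v ∷ inj₁ u ∷ inj₂ w ∷ inj₁ u′ ∷ inj₂ v′ ∷ []

∑fourPath≤numPaths : ∀ {m n} (B : BipGraph m n) v v′ →
  ∑[ u < m ] ∑[ w < n ] ∑[ u′ < m ] χ (isPathFromTo B 4 (inj₂ v) (inj₂ v′) (fourPath v u w u′ v′))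
  ≤ numPaths B 4 (inj₂ v) (inj₂ v′)
∑fourPath≤numPaths B v v′ =
  ≤-trans (∑-mono-≤ λ u → ∑-mono-≤ λ w → ∑-mono-≤ λ u′ →
             count-inj₂∷≤ (λ s → p (inj₂ v ∷ inj₁ u ∷ inj₂ w ∷ inj₁ u′ ∷ s)) v′)
  (≤-trans (∑-mono-≤ λ u → ∑-mono-≤ λ w → ∑-count-inj₁∷≤ (λ s → p (inj₂ v ∷ inj₁ u ∷ inj₂ w ∷ s)))
  (≤-trans (∑-mono-≤ λ u → ∑-count-inj₂∷≤ (λ s → p (inj₂ v ∷ inj₁ u ∷ s)))
  (≤-trans (∑-count-inj₁∷≤ (λ s → p (inj₂ v ∷ s)))
           (count-inj₂∷≤ p v))))
  where p = isPathFromTo B 4 (inj₂ v) (inj₂ v′)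

isPath-fourPath : ∀ {m n} (B : BipGraph m n) {v u w u′ v′} →
  T (B u v) → T (B u w) → T (B u′ w) → T (B u′ v′) → v ≢ w → v ≢ v′ → u ≢ u′ → w ≢ v′ →
  T (isPathFromTo B 4 (inj₂ v) (inj₂ v′) (fourPath v u w u′ v′))
isPath-fourPath B {v} {u} {w} {u′} {v′} uv uw u′w u′v′ v≢w v≢v′ u≢u′ w≢v′
  rewrite ≡-≟-identity _≟_ {v} refl | ≡-≟-identity _≟_ {v′} refl
        | ≢-≟-identity _≟_ v≢w | ≢-≟-identity _≟_ v≢v′ | ≢-≟-identity _≟_ u≢u′ | ≢-≟-identity _≟_ w≢v′
        | to T-≡ uv | to T-≡ uw | to T-≡ u′w | to T-≡ u′v′
  = tt

-- Grouped as a cherry u – w – u′ and its two ends, so that the ends can be counted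
-- one after the other.
isP₄ : ∀ {m n} → BipGraph m n → Fin n → Fin m → Fin n → Fin m → Fin n → Bool
isP₄ B v u w u′ v′ = cherry B u w u′ ∧ (w ≢ᵇ v ∧ B u v) ∧ (v ≢ᵇ v′ ∧ w ≢ᵇ v′ ∧ B u′ v′)

isP₄⇒isPath : ∀ {m n} (B : BipGraph m n) {v u w u′ v′} → T (isP₄ B v u w u′ v′) →
  T (isPathFromTo B 4 (inj₂ v) (inj₂ v′) (fourPath v u w u′ v′))
isP₄⇒isPath B {v} {u} {w} {u′} {v′} h =
  let c , l , r            = T-∧³ {cherry B u w u′} {w ≢ᵇ v ∧ B u v} h
      uw , u′w , u≢u′      = T-∧³ {B u w} {B u′ w} c
      w≢v , uv             = to (T-∧ {w ≢ᵇ v} {B u v}) l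
      v≢v′ , w≢v′ , u′v′   = T-∧³ {v ≢ᵇ v′} {w ≢ᵇ v′} r
  in isPath-fourPath B uv uw u′w u′v′ (≢-sym (T-≢ᵇ w≢v)) (T-≢ᵇ v≢v′) (T-≢ᵇ u≢u′) (T-≢ᵇ w≢v′)

isP₄⇒≢ : ∀ {m n} (B : BipGraph m n) {v u w u′ v′} → T (isP₄ B v u w u′ v′) → v ≢ v′
isP₄⇒≢ B {v} {u} {w} {u′} {v′} h =
  T-≢ᵇ (proj₁ (T-∧³ {v ≢ᵇ v′} {w ≢ᵇ v′} (proj₂ (proj₂ (T-∧³ {cherry B u w u′} {w ≢ᵇ v ∧ B u v} h)))))

∑isP₄≤ℓ : ∀ {m n ℓ} (B : BipGraph m n) → P≤4Free ℓ B → ∀ v v′ →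
  ∑[ u < m ] ∑[ w < n ] ∑[ u′ < m ] χ (isP₄ B v u w u′ v′) ≤ ℓ
∑isP₄≤ℓ {m} {n} {ℓ} B free v v′ = by-cases (v ≟ v′)
  where
  by-cases : Dec (v ≡ v′) → ∑[ u < m ] ∑[ w < n ] ∑[ u′ < m ] χ (isP₄ B v u w u′ v′) ≤ ℓ
  by-cases (yes v≡v′) =
    ≤-trans (≤-reflexive (∑-zero {m} λ u → ∑-zero {n} λ w → ∑-zero {m} λ u′ → χ≡0 λ h → isP₄⇒≢ B h v≡v′)) z≤n
  by-cases (no v≢v′) = begin
    ∑[ u < m ] ∑[ w < n ] ∑[ u′ < m ] χ (isP₄ B v u w u′ v′)
      ≤⟨ ∑-mono-≤ {m} (λ u → ∑-mono-≤ {n} λ w → ∑-mono-≤ {m} λ u′ → χ-mono (isP₄⇒isPath B)) ⟩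
    ∑[ u < m ] ∑[ w < n ] ∑[ u′ < m ] χ (isPathFromTo B 4 (inj₂ v) (inj₂ v′) (fourPath v u w u′ v′))
      ≤⟨ ∑fourPath≤numPaths B v v′ ⟩
    numPaths B 4 (inj₂ v) (inj₂ v′)
      ≤⟨ m≤n+m _ _ ⟩
    numPaths≤4 B (inj₂ v) (inj₂ v′)
      ≤⟨ free v v′ v≢v′ ⟩
    ℓ ∎
    where open ≤-Reasoning

cherry-extensions : ∀ {m n} (B : BipGraph m n) {u w u′} → T (cherry B u w u′) →
  (deg B u ∸ 1) * (deg B u′ ∸ 2) ≤ ∑[ v < n ] ∑[ v′ < n ] χ (isP₄ B v u w u′ v′)
cherry-extensions {n = n} B {u} {w} {u′} c = begin
  (deg B u ∸ 1) * (deg B u′ ∸ 2)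
    ≤⟨ *-monoˡ-≤ (deg B u′ ∸ 2) (∑χ∸1≤∑χ≢ (B u) w) ⟩
  ∑[ v < n ] χ (left v) * (deg B u′ ∸ 2)
    ≡⟨ *-distribʳ-sum (deg B u′ ∸ 2) (χ ∘ left) ⟩
  ∑[ v < n ] (χ (left v) * (deg B u′ ∸ 2))
    ≤⟨ ∑-mono-≤ (λ v → *-monoʳ-≤ (χ (left v)) (∑χ∸2≤∑χ≢≢ (B u′) v w)) ⟩
  ∑[ v < n ] (χ (left v) * ∑[ v′ < n ] χ (right v v′))
    ≡⟨ sum-cong-≗ (λ v → *-distribˡ-sum (χ (left v)) (χ ∘ right v)) ⟩
  ∑[ v < n ] ∑[ v′ < n ] (χ (left v) * χ (right v v′))
    ≤⟨ ∑-mono-≤ (λ v → ∑-mono-≤ λ v′ → ≤-trans (≤-reflexive (sym (χ-∧ (left v) (right v v′))))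
                                                  (χ-mono λ lr → from T-∧ (c , lr))) ⟩
  ∑[ v < n ] ∑[ v′ < n ] χ (isP₄ B v u w u′ v′)
    ∎
  where
  open ≤-Reasoning
  left : Fin n → Bool
  left v = w ≢ᵇ v ∧ B u v
  right : Fin n → Fin n → Bool
  right v v′ = v ≢ᵇ v′ ∧ w ≢ᵇ v′ ∧ B u′ v′

∑⁵-reorder : ∀ {m n} (F : Fin n → Fin m → Fin m → Fin n → Fin n → ℕ) →
  ∑[ w < n ] ∑[ u < m ] ∑[ u′ < m ] ∑[ v < n ] ∑[ v′ < n ] F w u u′ v v′
  ≡ ∑[ v < n ] ∑[ v′ < n ] ∑[ u < m ] ∑[ w < n ] ∑[ u′ < m ] F w u u′ v v′
∑⁵-reorder {m} {n} F = begin
  ∑[ w < n ] ∑[ u < m ] ∑[ u′ < m ] ∑[ v < n ] ∑[ v′ < n ] F w u u′ v v′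
    ≡⟨ sum-cong-≗ (λ w → sum-cong-≗ λ u → ∑-comm² λ u′ v v′ → F w u u′ v v′) ⟩
  ∑[ w < n ] ∑[ u < m ] ∑[ v < n ] ∑[ v′ < n ] ∑[ u′ < m ] F w u u′ v v′
    ≡⟨ sum-cong-≗ (λ w → ∑-comm² λ u v v′ → ∑[ u′ < m ] F w u u′ v v′) ⟩
  ∑[ w < n ] ∑[ v < n ] ∑[ v′ < n ] ∑[ u < m ] ∑[ u′ < m ] F w u u′ v v′
    ≡⟨ ∑-comm² (λ w v v′ → ∑[ u < m ] ∑[ u′ < m ] F w u u′ v v′) ⟩
  ∑[ v < n ] ∑[ v′ < n ] ∑[ w < n ] ∑[ u < m ] ∑[ u′ < m ] F w u u′ v v′
    ≡⟨ sum-cong-≗ (λ v → sum-cong-≗ λ v′ → ∑-comm λ w u → ∑[ u′ < m ] F w u u′ v v′) ⟩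
  ∑[ v < n ] ∑[ v′ < n ] ∑[ u < m ] ∑[ w < n ] ∑[ u′ < m ] F w u u′ v v′
    ∎
  where open ≡-Reasoning

module WeightBounds {m n} (B : BipGraph m n) (D : ℕ) where

  open Weights B D public

  cherryWeightAt≤∑isP₄ : ∀ w →
    cherryWeightAt w ≤ ∑[ u < m ] ∑[ u′ < m ] ∑[ v < n ] ∑[ v′ < n ] χ (isP₄ B v u w u′ v′)
  cherryWeightAt≤∑isP₄ w = ∑-mono-≤ λ u → ∑-mono-≤ λ u′ → χ*-≤ λ c →
    ≤-trans (*-mono-≤ (weight≤deg∸1 u) (m⊓n≤m (deg B u′ ∸ 2) D)) (cherry-extensions B c)
    where
    weight≤deg∸1 : ∀ u → weight u ≤ deg B u ∸ 1
    weight≤deg∸1 u = ≤-trans (m⊓n≤m (deg B u ∸ 2) D) (∸-monoʳ-≤ (deg B u) (s≤s z≤n))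

  ∑cherryWeightAt≤ : ∀ {ℓ} → P≤4Free ℓ B → ∑[ w < n ] cherryWeightAt w ≤ n * (n * ℓ)
  ∑cherryWeightAt≤ {ℓ} free = begin
    ∑[ w < n ] cherryWeightAt w
      ≤⟨ ∑-mono-≤ cherryWeightAt≤∑isP₄ ⟩
    ∑[ w < n ] ∑[ u < m ] ∑[ u′ < m ] ∑[ v < n ] ∑[ v′ < n ] χ (isP₄ B v u w u′ v′)
      ≡⟨ ∑⁵-reorder (λ w u u′ v v′ → χ (isP₄ B v u w u′ v′)) ⟩
    ∑[ v < n ] ∑[ v′ < n ] ∑[ u < m ] ∑[ w < n ] ∑[ u′ < m ] χ (isP₄ B v u w u′ v′)
      ≤⟨ ∑-mono-≤ (λ v → ∑-mono-≤ λ v′ → ∑isP₄≤ℓ B free v v′) ⟩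
    ∑[ v < n ] ∑[ v′ < n ] ℓ
      ≡⟨ sum-cong-≗ {n} (λ v → ∑-const n ℓ) ⟩
    ∑[ v < n ] (n * ℓ)
      ≡⟨ ∑-const n (n * ℓ) ⟩
    n * (n * ℓ)
      ∎
    where open ≤-Reasoning

  totalWeight-upper : ∀ {ℓ} → P≤4Free ℓ B → totalWeight * totalWeight ≤ n * (n * (n * ℓ) + D * totalWeight)
  totalWeight-upper {ℓ} free = begin
    totalWeight * totalWeight
      ≤⟨ cauchy-schwarz weightAt ⟩
    n * ∑[ w < n ] (weightAt w * weightAt w)
      ≤⟨ *-monoʳ-≤ n (∑-mono-≤ weightAt²) ⟩
    n * ∑[ w < n ] (cherryWeightAt w + D * weightAt w)
      ≡⟨ cong (n *_) (trans (∑-distrib-+ cherryWeightAt (λ w → D * weightAt w))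
                            (cong (∑[ w < n ] cherryWeightAt w +_) (sym (*-distribˡ-sum D weightAt)))) ⟩
    n * (∑[ w < n ] cherryWeightAt w + D * totalWeight)
      ≤⟨ *-monoʳ-≤ n (+-monoˡ-≤ (D * totalWeight) (∑cherryWeightAt≤ free)) ⟩
    n * (n * (n * ℓ) + D * totalWeight)
      ∎
    where open ≤-Reasoning

lemma3p7 : (m n ℓ : ℕ) → 1 ≤ m → 1 ≤ n → (B : BipGraph m n) → P≤4Free ℓ B
    → numEdges B < 10 * m + 10 * n
    ⊎ (numEdges B ∸ (10 * m + 10 * n)) ^ 4 < 256 * ℓ * n ^ 3 * m ^ 2
lemma3p7 m n ℓ 1≤m _ B free with numEdges B <? 10 * m + 10 * n
... | yes few  = inj₁ few
... | no ¬few = inj₂ (edge-arithmetic {m} {n} {ℓ} {e} {D} {totalWeight} 1≤m (≮⇒≥ ¬few) (m/n*n≤m e m) e<m+Dm totalWeight-lower (totalWeight-upper free))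
  where
  instance
    m≢0 : NonZero m
    m≢0 = >-nonZero 1≤m
  e = numEdges B
  D = e / m
  open WeightBounds B D
  e<m+Dm : e < m + D * m
  e<m+Dm = subst (_< m + D * m) (sym (m≡m%n+[m/n]*n e m)) (+-monoˡ-< (D * m) (m%n<n e m))
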